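{- Let $a,b$ be odd integers with $a\ge 1$ and $a>-b$, and let $T:\mathbb{N}\to\mathbb{N}$ be defined by $T(n)=n/2$ if $n$ is even and $T(n)=(an+b)/2$ if $n$ is odd. If $b>1$, then there exists $n\in\mathbb{N}$ such that $T^{(k)}(n)\neq 1$ for every integer $k\ge 0$.
   Context: $\mathbb{N}=\{1,2,3,\dots\}$; $T^{(k)}$ denotes the $k$-th iterate of $T$, with $T^{(0)}$ the identity. -}

module Defs where

open import Data.Nat using (ℕ; zero; suc)
open import Data.Integer using (ℤ; _+_; _*_; _/ℕ_; _%ℕ_)
open import Relation.Binary.PropositionalEquality using (_≡_)

Odd : ℤ → Set
Odd x = x %ℕ 2 ≡ 1

-- T is given on all of ℤ; the division by 2 is exact in both branches
-- whenever a, b are odd (and on ℕ the values stay positive when a ≥ 1, a > -b).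
T : ℤ → ℤ → ℤ → ℤ
T a b n with n %ℕ 2
... | zero  = n /ℕ 2
... | suc _ = (a * n + b) /ℕ 2

iter : ℤ → ℤ → ℕ → ℤ → ℤ
iter a b zero    n = n
iter a b (suc k) n = T a b (iter a b k n)

{-# OPTIONS --safe #-}
module Submission where

-- For odd a and b the multiples of b are closed under T: in the even branch
-- b ∣ 2h forces b ∣ h because b is odd, and in the odd branch b ∣ a n + b, which
-- is even.  So the orbit of n = b never leaves bℤ, and 1 ∉ bℤ when b > 1.

open import Defs
open import Data.Nat using (ℕ)
open import Data.Integer using (ℤ; +_; -_; _≤_; _<_)
open import Data.Product using (∃; _×_)
open import Relation.Binary.PropositionalEquality using (_≢_)

import Data.Nat as ℕ
import Data.Nat.Properties as ℕ
open import Data.Nat.Divisibility using (∣1⇒≡1)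
open import Data.Integer using (_+_; _*_; _-_; _/ℕ_; _%ℕ_; ∣_∣; +≤+; +<+)
open import Data.Integer.Properties using (+-identityˡ)
open import Data.Integer.DivMod using (a≡a%ℕn+[a/ℕn]*n; n%ℕd<d)
open import Data.Integer.Divisibility.Signed
  using (_∣_; divides; ∣⇒∣ᵤ; ∣-refl; ∣n⇒∣m*n; ∣m∣n⇒∣m+n; ∣m∣n⇒∣m-n; ∣m+n∣n⇒∣m)
open import Data.Integer.Tactic.RingSolver using (solve-∀)
open import Data.Product using (_,_)
open import Data.Empty using (⊥-elim)
open import Relation.Nullary using (¬_)
open import Relation.Binary.PropositionalEquality
  using (_≡_; refl; sym; trans; cong; cong₂; subst; module ≡-Reasoning)

∣1⇒∣k∣≡1 : ∀ {k} → k ∣ + 1 → ∣ k ∣ ≡ 1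
∣1⇒∣k∣≡1 k∣1 = ∣1⇒≡1 (∣⇒∣ᵤ k∣1)

2∤1 : ¬ (+ 2 ∣ + 1)
2∤1 2∣1 with ∣1⇒∣k∣≡1 2∣1
... | ()

n≡[n%ℕ2]+[n/ℕ2]*2 : ∀ n → n ≡ + (n %ℕ 2) + (n /ℕ 2) * + 2
n≡[n%ℕ2]+[n/ℕ2]*2 n = a≡a%ℕn+[a/ℕn]*n n 2

Odd⇒n≡1+[n/ℕ2]*2 : ∀ n → Odd n → n ≡ + 1 + (n /ℕ 2) * + 2
Odd⇒n≡1+[n/ℕ2]*2 n odd =
  trans (n≡[n%ℕ2]+[n/ℕ2]*2 n) (cong (λ r → + r + (n /ℕ 2) * + 2) odd)

n%ℕ2≡0⇒n≡[n/ℕ2]*2 : ∀ {n} → n %ℕ 2 ≡ 0 → n ≡ (n /ℕ 2) * + 2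
n%ℕ2≡0⇒n≡[n/ℕ2]*2 {n} even = trans (n≡[n%ℕ2]+[n/ℕ2]*2 n)
  (trans (cong (λ r → + r + (n /ℕ 2) * + 2) even) (+-identityˡ _))

n%ℕ2≡suc⇒Odd : ∀ {n r} → n %ℕ 2 ≡ ℕ.suc r → Odd n
n%ℕ2≡suc⇒Odd {n} eq with n %ℕ 2 | n%ℕd<d n 2
n%ℕ2≡suc⇒Odd refl | 1 | _ = refl
... | ℕ.suc (ℕ.suc _) | ℕ.s≤s (ℕ.s≤s ())

2∣n⇒n≡[n/ℕ2]*2 : ∀ {n} → + 2 ∣ n → n ≡ (n /ℕ 2) * + 2
2∣n⇒n≡[n/ℕ2]*2 {n} 2∣n with n %ℕ 2 in eq | n%ℕd<d n 2
... | 0 | _ = n%ℕ2≡0⇒n≡[n/ℕ2]*2 eq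
... | 1 | _ = ⊥-elim (2∤1 (∣m+n∣n⇒∣m 2∣1+[n/2]*2 (∣n⇒∣m*n (n /ℕ 2) ∣-refl)))
  where
  2∣1+[n/2]*2 : + 2 ∣ + 1 + (n /ℕ 2) * + 2
  2∣1+[n/2]*2 = subst (+ 2 ∣_) (Odd⇒n≡1+[n/ℕ2]*2 n eq) 2∣n
... | ℕ.suc (ℕ.suc _) | ℕ.s≤s (ℕ.s≤s ())

Odd⇒2∣a*n+b : ∀ a n b → Odd a → Odd n → Odd b → + 2 ∣ a * n + b
Odd⇒2∣a*n+b a n b odd-a odd-n odd-b = divides (+ 1 + p + q + p * q * + 2 + r) (begin
  a * n + b
    ≡⟨ cong₂ _+_ (cong₂ _*_ (Odd⇒n≡1+[n/ℕ2]*2 a odd-a) (Odd⇒n≡1+[n/ℕ2]*2 n odd-n))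
                 (Odd⇒n≡1+[n/ℕ2]*2 b odd-b) ⟩
  (+ 1 + p * + 2) * (+ 1 + q * + 2) + (+ 1 + r * + 2)
    ≡⟨ odd*odd+odd p q r ⟩
  (+ 1 + p + q + p * q * + 2 + r) * + 2 ∎)
  where
  open ≡-Reasoning
  p = a /ℕ 2
  q = n /ℕ 2
  r = b /ℕ 2
  odd*odd+odd : ∀ p q r → (+ 1 + p * + 2) * (+ 1 + q * + 2) + (+ 1 + r * + 2)
                        ≡ (+ 1 + p + q + p * q * + 2 + r) * + 2
  odd*odd+odd = solve-∀

-- With d = 1 + 2e one has h = h d − e (h · 2), a combination of multiples of d.
Odd⇒∣h*2⇒∣h : ∀ {d h} → Odd d → d ∣ h * + 2 → d ∣ h
Odd⇒∣h*2⇒∣h {d} {h} odd-d d∣2h = subst (d ∣_) h*d-e*[h*2]≡h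
  (∣m∣n⇒∣m-n (∣n⇒∣m*n h ∣-refl) (∣n⇒∣m*n e d∣2h))
  where
  e = d /ℕ 2
  identity : ∀ h e → h * (+ 1 + e * + 2) - e * (h * + 2) ≡ h
  identity = solve-∀
  h*d-e*[h*2]≡h : h * d - e * (h * + 2) ≡ h
  h*d-e*[h*2]≡h = trans (cong (λ t → h * t - e * (h * + 2)) (Odd⇒n≡1+[n/ℕ2]*2 d odd-d))
                        (identity h e)

Odd⇒∣n⇒∣n/ℕ2 : ∀ {d n} → Odd d → + 2 ∣ n → d ∣ n → d ∣ n /ℕ 2
Odd⇒∣n⇒∣n/ℕ2 {d} {n} odd-d 2∣n d∣n =
  Odd⇒∣h*2⇒∣h odd-d (subst (d ∣_) (2∣n⇒n≡[n/ℕ2]*2 2∣n) d∣n)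

T-preserves-∣ : ∀ {a b n} → Odd a → Odd b → b ∣ n → b ∣ T a b n
T-preserves-∣ {a} {b} {n} odd-a odd-b b∣n with n %ℕ 2 in eq
... | 0       = Odd⇒∣n⇒∣n/ℕ2 odd-b
                  (divides (n /ℕ 2) (n%ℕ2≡0⇒n≡[n/ℕ2]*2 eq)) b∣n
... | ℕ.suc _ = Odd⇒∣n⇒∣n/ℕ2 odd-b
                  (Odd⇒2∣a*n+b a n b odd-a (n%ℕ2≡suc⇒Odd {n} eq) odd-b)
                  (∣m∣n⇒∣m+n (∣n⇒∣m*n a b∣n) ∣-refl)

iter-preserves-∣ : ∀ {a b n} → Odd a → Odd b → b ∣ n → ∀ k → b ∣ iter a b k n
iter-preserves-∣ odd-a odd-b b∣n ℕ.zero    = b∣n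
iter-preserves-∣ odd-a odd-b b∣n (ℕ.suc k) =
  T-preserves-∣ odd-a odd-b (iter-preserves-∣ odd-a odd-b b∣n k)

mainTheorem2 : (a b : ℤ) → Odd a → Odd b → + 1 ≤ a → - b < a → + 1 < b →
    ∃ λ (n : ℕ) → + 1 ≤ + n × ((k : ℕ) → iter a b k (+ n) ≢ + 1)
mainTheorem2 a (+ n) odd-a odd-b _ _ (+<+ 1<n) = n , +≤+ (ℕ.<⇒≤ 1<n) , orbit-avoids-1
  where
  orbit-avoids-1 : ∀ k → iter a (+ n) k (+ n) ≢ + 1
  orbit-avoids-1 k iter≡1 = ℕ.<⇒≢ 1<n (sym (∣1⇒∣k∣≡1
    (subst (+ n ∣_) iter≡1 (iter-preserves-∣ odd-a odd-b ∣-refl k))))
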